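{- Let $n,\lambda\in\mathbb{N}$ and let $\mathcal{H}=\{H_1,\dots,H_m\}$ be a bipartite covering of the multigraph $K_n^{\lambda}$. Then $${\rm cap}(\mathcal{H}) \geq \max\left\{2 \lambda (n-1), \enspace n\left( \log n + \left\lfloor \frac{\lambda - 1}{2} \right\rfloor \log \left(\frac{\log n}{\lambda} \right) - \lambda -1 \right)\right\}.$$
   Context: All logarithms are to base $2$. $K_n^{\lambda}$ denotes the complete multigraph on an $n$-element vertex set $V$ in which every pair of distinct vertices is joined by an edge of multiplicity $\lambda$. For a multigraph $G$, a bipartite covering of $G$ is a finite collection $\mathcal{H}=\{H_1,\dots,H_m\}$ of (simple) bipartite graphs with $V(H_i)\subseteq V(G)$ such that for every pair $e$ of vertices joined in $G$ with multiplicity $\mu$, there are at least $\mu$ distinct indices $i\in[m]$ with $e\in E(H_i)$. The capacity is ${\rm cap}(\mathcal{H})=\sum_{i=1}^m |H_i|$, where $|H_i|$ is the number of vertices of $H_i$. -}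

module Defs where

open import Data.Nat using (ℕ; _+_; _*_; _∸_; _/_)
open import Data.Bool using (Bool; true; false)
open import Data.Fin using (Fin)
open import Data.Fin.Subset using (Subset; _∈_; ∣_∣)
open import Data.List using (List; map; allFin)
open import Data.Nat.ListAction using (sum)
open import Data.Product using (Σ; _×_)
open import Function.Definitions using (Injective)
open import Relation.Binary.PropositionalEquality using (_≡_; _≢_)

record BipGraph (n : ℕ) : Set where
  field
    verts   : Subset n
    adj     : Fin n → Fin n → Bool
    adj-sym : ∀ u v → adj u v ≡ adj v u
    loopless : ∀ u → adj u u ≡ false
    adj-in  : ∀ u v → adj u v ≡ true → u ∈ verts
    colour  : Fin n → Bool
    proper  : ∀ u v → adj u v ≡ true → colour u ≢ colour v

open BipGraph public

order : ∀ {n} → BipGraph n → ℕ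
order H = ∣ verts H ∣

cap : ∀ {n m} → (Fin m → BipGraph n) → ℕ
cap {m = m} H = sum (map (λ i → order (H i)) (allFin m))

-- H is a bipartite covering of K_n^l: every pair u ≠ v lies in at least l
-- distinct members, i.e. there are l distinct indices i with uv ∈ E(H_i).
IsBipCoveringK : (n l m : ℕ) → (Fin m → BipGraph n) → Set
IsBipCoveringK n l m H =
  ∀ (u v : Fin n) → u ≢ v →
    Σ (Fin l → Fin m) λ f → Injective _≡_ _≡_ f × (∀ j → adj (H (f j)) u v ≡ true)

halfFloor : ℕ → ℕ
halfFloor l = (l ∸ 1) / 2

-- First bound, by double counting: every vertex lies on λ (n - 1) edges of K_n^λ, while a bipartite H_i with parts
-- of sizes a and b has at most a b ≤ (a + b)²/4 ≤ |H_i| n/4 edges.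
-- Second bound: give vertex v the word of length m over {0, 1, ∗} whose i-th letter is the colour of v in H_i, or ∗
-- if v ∉ H_i. Two vertices are adjacent, with different colours, in at least λ of the H_i, so their words disagree
-- in at least λ positions, and the sets B_v of binary words disagreeing with the word of v in at most
-- k = ⌊(λ - 1)/2⌋ positions are pairwise disjoint. If the word of v has c_v letters other than ∗, then
-- |B_v| = 2^(m - c_v) V(k, c_v) with V(k, c) = Σ_{j ≤ k} (c choose j), so Σ_v V(k, c_v) 2^(-c_v) ≤ 1 (Kraft),
-- while Σ_v c_v = cap(H). Let c₀ be least with n p^k ≤ 2^(c₀ + λ + 1) (λ d)^k, where 2^p ≤ n^d. Minimality of c₀
-- and (c + λ)^k ≤ (2λ)^k V(k, c) give n V(k, c) 2^(-c) ≥ c₀ + 1 - c for c ≤ c₀, hence c + n V(k, c) 2^(-c) ≥ c₀ + 1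
-- for every c. Summing over v gives cap(H) ≥ n c₀, and the n-th power of the inequality defining c₀ is the bound.
module Submission where

open import Defs
open import Data.Nat using (ℕ; _+_; _*_; _∸_; _^_; _≤_)
open import Data.Fin using (Fin)
open import Data.Product using (_×_)

open import Data.Bool using (Bool; true; false; not; _xor_; if_then_else_)
open import Data.Empty using (⊥; ⊥-elim)
open import Data.Fin using (zero; suc; punchIn; punchOut)
import Data.Fin.Properties as Fin
open import Data.Fin.Subset using (Subset; ∣_∣)
open import Data.Fin.Subset.Properties using (∣p∣≤n)
open import Data.List using (tabulate)
open import Data.List.Properties using (map-tabulate)
open import Data.Maybe using (Maybe; just; nothing; is-just)
open import Data.Nat using (zero; suc; _<_; _>_; z≤n; s≤s; NonZero; >-nonZero)
open import Data.Nat.DivMod using (_/_; m/n*n≤m)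
import Data.Nat.ListAction as List
open import Data.Nat.Properties
open import Data.Nat.Tactic.RingSolver using (solve-∀)
open import Data.Product using (_,_; proj₁; proj₂; ∃)
open import Data.Sum using (inj₁; inj₂; [_,_]′)
open import Data.Vec using (lookup)
import Data.Vec as Vec
open import Data.Vec.Functional using (head; tail; removeAt)
open import Data.Vec.Properties using ([]=⇒lookup)
open import Function using (_∘_)
open import Function.Definitions using (Injective)
open import Relation.Binary.PropositionalEquality
  using (_≡_; _≢_; refl; sym; trans; cong; cong₂; subst; subst₂; module ≡-Reasoning)
open import Relation.Nullary using (Dec; yes; no; ¬_)

open import Algebra.Properties.Semiring.Sum +-*-semiring
  using (sum; sum-syntax; ∑-distrib-+; ∑-comm; sum-cong-≗; sum-remove; *-distribˡ-sum; *-distribʳ-sum)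
import Algebra.Properties.CommutativeSemigroup *-commutativeSemigroup as *

sum-mono-≤ : ∀ {n} {f g : Fin n → ℕ} → (∀ i → f i ≤ g i) → sum f ≤ sum g
sum-mono-≤ {zero} _ = z≤n
sum-mono-≤ {suc n} f≤g = +-mono-≤ (f≤g zero) (sum-mono-≤ (f≤g ∘ suc))

∑-const : ∀ n a → ∑[ i < n ] a ≡ n * a
∑-const zero a = refl
∑-const (suc n) a = cong (a +_) (∑-const n a)

∑∑-product : ∀ {m n} (f : Fin m → ℕ) (g : Fin n → ℕ) → ∑[ u < m ] ∑[ v < n ] (f u * g v) ≡ sum f * sum g
∑∑-product f g = trans (sum-cong-≗ (λ u → sym (*-distribˡ-sum (f u) g))) (sym (*-distribʳ-sum (sum g) f))

sum∘injection≤sum : ∀ {l m} (f : Fin l → Fin m) → Injective _≡_ _≡_ f → (g : Fin m → ℕ) →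
  ∑[ j < l ] g (f j) ≤ sum g
sum∘injection≤sum {zero} f _ g = z≤n
sum∘injection≤sum {suc l} {zero} f _ g with () ← f zero
sum∘injection≤sum {suc l} {suc m} f f-inj g = begin
    g (f zero) + ∑[ j < l ] g (f (suc j))  ≡⟨ cong (g (f zero) +_) (sum-cong-≗ (cong g ∘ sym ∘ Fin.punchIn-punchOut ∘ f0≢f[1+j])) ⟩
    g (f zero) + ∑[ j < l ] g′ (f′ j)      ≤⟨ +-monoʳ-≤ (g (f zero)) (sum∘injection≤sum f′ f′-inj g′) ⟩
    g (f zero) + sum g′                    ≡⟨ sym (sum-remove {i = f zero} g) ⟩
    sum g                                  ∎
  where
  open ≤-Reasoning
  f0≢f[1+j] : ∀ j → f zero ≢ f (suc j)
  f0≢f[1+j] j eq = Fin.0≢1+n (f-inj eq)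
  f′ : Fin l → Fin m
  f′ j = punchOut (f0≢f[1+j] j)
  f′-inj : Injective _≡_ _≡_ f′
  f′-inj eq = Fin.suc-injective (f-inj (Fin.punchOut-injective (f0≢f[1+j] _) (f0≢f[1+j] _) eq))
  g′ : Fin m → ℕ
  g′ = removeAt g (f zero)

sum-except-≥ : ∀ {n} l (g : Fin n → ℕ) u → (∀ v → u ≢ v → l ≤ g v) → l * (n ∸ 1) ≤ sum g
sum-except-≥ {suc n} l g u l≤g = begin
    l * n                     ≡⟨ trans (*-comm l n) (sym (∑-const n l)) ⟩
    ∑[ j < n ] l              ≤⟨ sum-mono-≤ (λ j → l≤g (punchIn u j) (Fin.punchInᵢ≢i u j ∘ sym)) ⟩
    sum (removeAt g u)        ≤⟨ m≤n+m _ (g u) ⟩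
    g u + sum (removeAt g u)  ≡⟨ sym (sum-remove {i = u} g) ⟩
    sum g                     ∎
  where open ≤-Reasoning

sum≤1 : ∀ {n} (f : Fin n → ℕ) → (∀ i → f i ≤ 1) → (∀ {i j} → i ≢ j → 0 < f i → 0 < f j → ⊥) → sum f ≤ 1
sum≤1 {zero} f _ _ = z≤n
sum≤1 {suc n} f f≤1 unique with f zero in f0≡
... | zero = sum≤1 (f ∘ suc) (f≤1 ∘ suc) (λ i≢j → unique (i≢j ∘ Fin.suc-injective))
... | suc a = begin
    suc a + sum (f ∘ suc)  ≡⟨ cong (suc a +_) (trans (sum-cong-≗ tail≡0) (trans (∑-const n 0) (*-zeroʳ n))) ⟩
    suc a + 0              ≡⟨ trans (+-identityʳ (suc a)) (sym f0≡) ⟩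
    f zero                 ≤⟨ f≤1 zero ⟩
    1                      ∎
  where
  open ≤-Reasoning
  tail≡0 : ∀ i → f (suc i) ≡ 0
  tail≡0 i with f (suc i) in fi≡
  ... | zero = refl
  ... | suc _ with () ← unique {zero} {suc i} (λ ()) (subst (0 <_) (sym f0≡) (s≤s z≤n)) (subst (0 <_) (sym fi≡) (s≤s z≤n))

List-sum-tabulate : ∀ {m} (g : Fin m → ℕ) → List.sum (tabulate g) ≡ sum g
List-sum-tabulate {zero} g = refl
List-sum-tabulate {suc m} g = cong (g zero +_) (List-sum-tabulate (g ∘ suc))

n<2^n : ∀ n → n < 2 ^ n
n<2^n zero = s≤s z≤n
n<2^n (suc n) = subst (_≤ 2 ^ suc n) (+-comm (suc n) 1)
  (+-mono-≤ (n<2^n n) (subst (1 ≤_) (sym (+-identityʳ (2 ^ n))) (m^n>0 2 n)))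

2^m≤2^n⇒m≤n : ∀ {m n} → 2 ^ m ≤ 2 ^ n → m ≤ n
2^m≤2^n⇒m≤n le = ≮⇒≥ (λ n<m → <⇒≱ (^-monoʳ-< 2 (s≤s (s≤s z≤n)) n<m) le)

^-distribʳ-* : ∀ m n o → (m * n) ^ o ≡ m ^ o * n ^ o
^-distribʳ-* m n zero = refl
^-distribʳ-* m n (suc o) = trans (cong (m * n *_) (^-distribʳ-* m n o)) (*.interchange m n (m ^ o) (n ^ o))

4*[a*b]≤[a+b]*[a+b] : ∀ a b → 4 * (a * b) ≤ (a + b) * (a + b)
4*[a*b]≤[a+b]*[a+b] a b = [ ordered , swapped ]′ (≤-total a b)
  where
  square : ∀ a e → 4 * (a * (a + e)) + e * e ≡ (a + (a + e)) * (a + (a + e))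
  square = solve-∀
  ordered : ∀ {a b} → a ≤ b → 4 * (a * b) ≤ (a + b) * (a + b)
  ordered {a} {b} a≤b = subst (λ b → 4 * (a * b) ≤ (a + b) * (a + b)) (m+[n∸m]≡n a≤b)
    (≤-trans (m≤m+n _ ((b ∸ a) * (b ∸ a))) (≤-reflexive (square a (b ∸ a))))
  swapped : b ≤ a → 4 * (a * b) ≤ (a + b) * (a + b)
  swapped b≤a = subst₂ _≤_ (cong (4 *_) (*-comm b a)) (cong (λ s → s * s) (+-comm b a)) (ordered b≤a)

[1+k+e]^k*e≤[k+e]^[1+k] : ∀ k e → suc (k + e) ^ k * e ≤ (k + e) ^ suc k
[1+k+e]^k*e≤[k+e]^[1+k] zero e = ≤-reflexive (*-comm 1 e)
[1+k+e]^k*e≤[k+e]^[1+k] (suc k) e = *-cancelʳ-≤ _ _ (suc e) (begin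
    suc a ^ suc k * e * suc e           ≡⟨ regroup (suc a ^ k) (suc a) e ⟩
    suc a ^ k * suc e * (suc a * e)     ≤⟨ *-mono-≤ ih [1+a]*e≤a*[1+e] ⟩
    a ^ suc k * (a * suc e)             ≡⟨ *.x∙yz≈yx∙z (a ^ suc k) a (suc e) ⟩
    a ^ suc (suc k) * suc e             ∎)
  where
  open ≤-Reasoning
  a = suc (k + e)
  ih : suc a ^ k * suc e ≤ a ^ suc k
  ih = subst (λ b → suc b ^ k * suc e ≤ b ^ suc k) (+-suc k e) ([1+k+e]^k*e≤[k+e]^[1+k] k (suc e))
  [1+a]*e≤a*[1+e] : suc a * e ≤ a * suc e
  [1+a]*e≤a*[1+e] = ≤-trans (+-monoˡ-≤ (a * e) (m≤n+m e (suc k))) (≤-reflexive (sym (*-suc a e)))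
  regroup : ∀ x y e → y * x * e * suc e ≡ x * suc e * (y * e)
  regroup = solve-∀

[1+a]^k≤2*a^k : ∀ a k → 2 * k ≤ a → suc a ^ k ≤ 2 * a ^ k
[1+a]^k≤2*a^k zero zero _ = s≤s z≤n
[1+a]^k≤2*a^k a@(suc _) k 2k≤a = *-cancelʳ-≤ _ _ a (begin
    suc a ^ k * a          ≤⟨ *-monoʳ-≤ (suc a ^ k) a≤2e ⟩
    suc a ^ k * (2 * e)    ≡⟨ *.x∙yz≈y∙xz (suc a ^ k) 2 e ⟩
    2 * (suc a ^ k * e)    ≤⟨ *-monoʳ-≤ 2 (subst (λ b → suc b ^ k * e ≤ b ^ suc k) k+e≡a ([1+k+e]^k*e≤[k+e]^[1+k] k e)) ⟩
    2 * (a * a ^ k)        ≡⟨ cong (2 *_) (*-comm a (a ^ k)) ⟩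
    2 * (a ^ k * a)        ≡⟨ sym (*-assoc 2 (a ^ k) a) ⟩
    2 * a ^ k * a          ∎)
  where
  open ≤-Reasoning
  e = a ∸ k
  k+e≡a : k + e ≡ a
  k+e≡a = m+[n∸m]≡n (≤-trans (m≤m+n k (k + 0)) 2k≤a)
  k≤e : k ≤ e
  k≤e = +-cancelˡ-≤ k k e (subst (k + k ≤_) (sym k+e≡a) (subst (λ z → k + z ≤ a) (+-identityʳ k) 2k≤a))
  a≤2e : a ≤ 2 * e
  a≤2e = begin
    a       ≡⟨ sym k+e≡a ⟩
    k + e   ≤⟨ +-monoˡ-≤ e k≤e ⟩
    e + e   ≡⟨ cong (e +_) (sym (+-identityʳ e)) ⟩
    2 * e   ∎

[1+x]^[1+j]≤x^[1+j]+[1+j]*[1+x]^j : ∀ x j → suc x ^ suc j ≤ x ^ suc j + suc j * suc x ^ j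
[1+x]^[1+j]≤x^[1+j]+[1+j]*[1+x]^j x zero = ≤-reflexive (expand x)
  where
  expand : ∀ x → suc x * 1 ≡ x * 1 + 1 * 1
  expand = solve-∀
[1+x]^[1+j]≤x^[1+j]+[1+j]*[1+x]^j x (suc j) = begin
    suc x * suc x ^ suc j                              ≤⟨ *-monoʳ-≤ (suc x) ([1+x]^[1+j]≤x^[1+j]+[1+j]*[1+x]^j x j) ⟩
    suc x * (P + suc j * Q)                            ≡⟨ expand x P Q j ⟩
    x * P + P + suc j * suc x ^ suc j                  ≤⟨ +-monoˡ-≤ _ (+-monoʳ-≤ (x * P) (^-monoˡ-≤ (suc j) (n≤1+n x))) ⟩
    x * P + suc x ^ suc j + suc j * suc x ^ suc j      ≡⟨ collect (x * P) (suc x ^ suc j) j ⟩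
    x ^ suc (suc j) + suc (suc j) * suc x ^ suc j      ∎
  where
  open ≤-Reasoning
  P = x ^ suc j
  Q = suc x ^ j
  expand : ∀ x P Q j → suc x * (P + suc j * Q) ≡ x * P + P + suc j * (suc x * Q)
  expand = solve-∀
  collect : ∀ A R j → A + R + suc j * R ≡ A + suc (suc j) * R
  collect = solve-∀

y^[1+k]≤2^y*x^k : ∀ {x y} k → 2 * k + 1 ≤ x → x < y → y ^ suc k ≤ 2 ^ y * x ^ k
y^[1+k]≤2^y*x^k {x} {suc y} k 2k+1≤x (s≤s x≤y) with m≤n⇒m<n∨m≡n x≤y
... | inj₂ refl = begin
    suc x * suc x ^ k    ≤⟨ *-mono-≤ (n<2^n x) ([1+a]^k≤2*a^k x k (≤-trans (m≤m+n (2 * k) 1) 2k+1≤x)) ⟩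
    2 ^ x * (2 * x ^ k)  ≡⟨ *.x∙yz≈yx∙z (2 ^ x) 2 (x ^ k) ⟩
    2 ^ suc x * x ^ k    ∎
  where open ≤-Reasoning
... | inj₁ x<y = begin
    suc y ^ suc k        ≤⟨ [1+a]^k≤2*a^k y (suc k) 2[1+k]≤y ⟩
    2 * y ^ suc k        ≤⟨ *-monoʳ-≤ 2 (y^[1+k]≤2^y*x^k k 2k+1≤x x<y) ⟩
    2 * (2 ^ y * x ^ k)  ≡⟨ sym (*-assoc 2 (2 ^ y) (x ^ k)) ⟩
    2 ^ suc y * x ^ k    ∎
  where
  open ≤-Reasoning
  2[1+k]≤y : 2 * suc k ≤ y
  2[1+k]≤y = ≤-trans (≤-reflexive (double-suc k)) (≤-trans (s≤s 2k+1≤x) x<y)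
    where
    double-suc : ∀ k → 2 * suc k ≡ suc (2 * k + 1)
    double-suc = solve-∀

[1+t]*[x+1+t]^k≤2^[1+t+k]*x^k : ∀ x k t → 2 * k + 1 ≤ x → suc t * (x + suc t) ^ k ≤ 2 ^ (suc t + k) * x ^ k
[1+t]*[x+1+t]^k≤2^[1+t+k]*x^k x k t 2k+1≤x with suc t ≤? x
... | yes 1+t≤x = begin
    suc t * (x + suc t) ^ k      ≤⟨ *-mono-≤ (<⇒≤ (n<2^n (suc t))) (^-monoˡ-≤ k (+-monoʳ-≤ x 1+t≤x)) ⟩
    2 ^ suc t * (x + x) ^ k      ≡⟨ cong (λ z → 2 ^ suc t * (x + z) ^ k) (sym (+-identityʳ x)) ⟩
    2 ^ suc t * (2 * x) ^ k      ≡⟨ cong (2 ^ suc t *_) (^-distribʳ-* 2 x k) ⟩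
    2 ^ suc t * (2 ^ k * x ^ k)  ≡⟨ sym (*-assoc (2 ^ suc t) (2 ^ k) (x ^ k)) ⟩
    2 ^ suc t * 2 ^ k * x ^ k    ≡⟨ cong (_* x ^ k) (sym (^-distribˡ-+-* 2 (suc t) k)) ⟩
    2 ^ (suc t + k) * x ^ k      ∎
  where open ≤-Reasoning
... | no 1+t≰x = begin
    suc t * (x + suc t) ^ k      ≤⟨ *-monoʳ-≤ (suc t) (^-monoˡ-≤ k (+-monoˡ-≤ (suc t) (<⇒≤ x<1+t))) ⟩
    suc t * (suc t + suc t) ^ k  ≡⟨ cong (λ z → suc t * (suc t + z) ^ k) (sym (+-identityʳ (suc t))) ⟩
    suc t * (2 * suc t) ^ k      ≡⟨ cong (suc t *_) (^-distribʳ-* 2 (suc t) k) ⟩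
    suc t * (2 ^ k * suc t ^ k)  ≡⟨ *.x∙yz≈y∙xz (suc t) (2 ^ k) (suc t ^ k) ⟩
    2 ^ k * suc t ^ suc k        ≤⟨ *-monoʳ-≤ (2 ^ k) (y^[1+k]≤2^y*x^k k 2k+1≤x x<1+t) ⟩
    2 ^ k * (2 ^ suc t * x ^ k)  ≡⟨ sym (*-assoc (2 ^ k) (2 ^ suc t) (x ^ k)) ⟩
    2 ^ k * 2 ^ suc t * x ^ k    ≡⟨ cong (_* x ^ k) (sym (^-distribˡ-+-* 2 k (suc t))) ⟩
    2 ^ (k + suc t) * x ^ k      ≡⟨ cong (λ z → 2 ^ z * x ^ k) (+-comm k (suc t)) ⟩
    2 ^ (suc t + k) * x ^ k      ∎
  where
  open ≤-Reasoning
  x<1+t : x < suc t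
  x<1+t = ≰⇒> 1+t≰x

-- Volumes of Hamming balls

-- ballVolume ρ c = Σ_{j < ρ} (c choose j) is the number of points of {0,1}^c at distance less than ρ from a given one.
ballVolume : ℕ → ℕ → ℕ
ballVolume zero c = 0
ballVolume (suc ρ) zero = 1
ballVolume (suc ρ) (suc c) = ballVolume (suc ρ) c + ballVolume ρ c

ballVolume>0 : ∀ r c → ballVolume (suc r) c > 0
ballVolume>0 r zero = s≤s z≤n
ballVolume>0 r (suc c) = ≤-trans (ballVolume>0 r c) (m≤m+n _ _)

ballVolume-suc : ∀ ρ c → ballVolume ρ (suc c) ≡ ballVolume ρ c + ballVolume (ρ ∸ 1) c
ballVolume-suc zero c = refl
ballVolume-suc (suc ρ) c = refl

ballVolume-lower-bound : ∀ l c j → 2 * j ≤ l → (c + l) ^ j ≤ (2 * l) ^ j * ballVolume (suc j) c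
ballVolume-lower-bound l zero j _ = ≤-trans (^-monoˡ-≤ j (m≤m+n l (l + 0))) (≤-reflexive (sym (*-identityʳ _)))
ballVolume-lower-bound l (suc c) zero _ = ≤-trans (ballVolume>0 0 (suc c)) (≤-reflexive (sym (*-identityˡ _)))
ballVolume-lower-bound l (suc c) (suc j) 2[1+j]≤l = begin
    suc x ^ suc j                         ≤⟨ [1+x]^[1+j]≤x^[1+j]+[1+j]*[1+x]^j x j ⟩
    x ^ suc j + suc j * suc x ^ j         ≤⟨ +-mono-≤ (ballVolume-lower-bound l c (suc j) 2[1+j]≤l)
                                                      (*-monoʳ-≤ (suc j) ([1+a]^k≤2*a^k x j (≤-trans 2j≤l (m≤n+m l c)))) ⟩
    L ^ suc j * V₁ + suc j * (2 * x ^ j)  ≡⟨ cong (L ^ suc j * V₁ +_) (*-assoc-2 (suc j) (x ^ j)) ⟩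
    L ^ suc j * V₁ + 2 * suc j * x ^ j    ≤⟨ +-monoʳ-≤ (L ^ suc j * V₁)
                                                      (*-mono-≤ (*-monoʳ-≤ 2 1+j≤l) (ballVolume-lower-bound l c j 2j≤l)) ⟩
    L ^ suc j * V₁ + L * (L ^ j * V₀)     ≡⟨ factor (L ^ j) L V₁ V₀ ⟩
    L ^ suc j * (V₁ + V₀)                 ∎
  where
  open ≤-Reasoning
  x = c + l
  L = 2 * l
  V₁ = ballVolume (suc (suc j)) c
  V₀ = ballVolume (suc j) c
  2j≤l : 2 * j ≤ l
  2j≤l = ≤-trans (*-monoʳ-≤ 2 (n≤1+n j)) 2[1+j]≤l
  1+j≤l : suc j ≤ l
  1+j≤l = ≤-trans (m≤m+n (suc j) (suc j + 0)) 2[1+j]≤l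
  *-assoc-2 : ∀ s y → s * (2 * y) ≡ 2 * s * y
  *-assoc-2 = solve-∀
  factor : ∀ Z L b₁ b₀ → L * Z * b₁ + L * (Z * b₀) ≡ L * Z * (b₁ + b₀)
  factor = solve-∀

ballVolume-dominates : ∀ l k c t → 2 * k + 1 ≤ l →
  suc t * (c + l + suc t) ^ k ≤ 2 ^ (t + l) * l ^ k * ballVolume (suc k) c
ballVolume-dominates l k c t 2k+1≤l = begin
    suc t * (c + l + suc t) ^ k            ≤⟨ [1+t]*[x+1+t]^k≤2^[1+t+k]*x^k (c + l) k t (≤-trans 2k+1≤l (m≤n+m l c)) ⟩
    2 ^ (suc t + k) * (c + l) ^ k          ≤⟨ *-monoʳ-≤ (2 ^ (suc t + k))
                                                          (ballVolume-lower-bound l c k (≤-trans (m≤m+n (2 * k) 1) 2k+1≤l)) ⟩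
    2 ^ (suc t + k) * ((2 * l) ^ k * V)    ≡⟨ cong (λ z → 2 ^ (suc t + k) * (z * V)) (^-distribʳ-* 2 l k) ⟩
    2 ^ (suc t + k) * (2 ^ k * l ^ k * V)  ≡⟨ regroup (2 ^ (suc t + k)) (2 ^ k) (l ^ k) V ⟩
    2 ^ (suc t + k) * 2 ^ k * l ^ k * V    ≡⟨ cong (λ z → z * l ^ k * V) (sym (^-distribˡ-+-* 2 (suc t + k) k)) ⟩
    2 ^ (suc t + k + k) * l ^ k * V        ≤⟨ *-monoˡ-≤ V (*-monoˡ-≤ (l ^ k) (^-monoʳ-≤ 2 exponent≤)) ⟩
    2 ^ (t + l) * l ^ k * V                ∎
  where
  open ≤-Reasoning
  V = ballVolume (suc k) c
  regroup : ∀ A P L b → A * (P * L * b) ≡ A * P * L * b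
  regroup = solve-∀
  rearrange : ∀ t k → suc t + k + k ≡ t + (2 * k + 1)
  rearrange = solve-∀
  exponent≤ : suc t + k + k ≤ t + l
  exponent≤ = ≤-trans (≤-reflexive (rearrange t k)) (+-monoʳ-≤ t 2k+1≤l)

-- Partial words and Kraft's inequality

indicator : Bool → ℕ
indicator true = 1
indicator false = 0

-- nothing is the blank letter ∗.
PartialWord : ℕ → Set
PartialWord m = Fin m → Maybe Bool

disagree : Maybe Bool → Maybe Bool → ℕ
disagree (just b) (just c) = indicator (b xor c)
disagree _ _ = 0

distance : ∀ {m} → PartialWord m → PartialWord m → ℕ
distance x y = ∑[ i < _ ] disagree (x i) (y i)

defined : ∀ {m} → PartialWord m → ℕ
defined x = ∑[ i < _ ] indicator (is-just (x i))

disagree-triangle : ∀ b h h′ → disagree h h′ ≤ disagree (just b) h + disagree (just b) h′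
disagree-triangle true  (just true)  (just false) = s≤s z≤n
disagree-triangle true  (just false) (just true)  = s≤s z≤n
disagree-triangle false (just true)  (just false) = s≤s z≤n
disagree-triangle false (just false) (just true)  = s≤s z≤n
disagree-triangle _     (just true)  (just true)  = z≤n
disagree-triangle _     (just false) (just false) = z≤n
disagree-triangle _     (just _)     nothing      = z≤n
disagree-triangle _     nothing      _            = z≤n

-- ball ρ x is the number of binary words that disagree with x in fewer than ρ positions.
ball : ∀ {m} → ℕ → PartialWord m → ℕ
ball {zero} zero _ = 0
ball {zero} (suc _) _ = 1
ball {suc m} ρ x = ball (ρ ∸ disagree (just true) (head x)) (tail x) + ball (ρ ∸ disagree (just false) (head x)) (tail x)

ball-size-step : ∀ m ρ (y : PartialWord m) →
  ball ρ y * 2 ^ defined y ≡ 2 ^ m * ballVolume ρ (defined y) →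
  ball (ρ ∸ 1) y * 2 ^ defined y ≡ 2 ^ m * ballVolume (ρ ∸ 1) (defined y) →
  (ball ρ y + ball (ρ ∸ 1) y) * 2 ^ suc (defined y) ≡ 2 ^ suc m * ballVolume ρ (suc (defined y))
ball-size-step m ρ y eq₁ eq₀ = begin
    (b₁ + b₀) * (2 * 2 ^ c)                                      ≡⟨ distrib b₁ b₀ (2 ^ c) ⟩
    2 * (b₁ * 2 ^ c + b₀ * 2 ^ c)                                ≡⟨ cong (2 *_) (cong₂ _+_ eq₁ eq₀) ⟩
    2 * (2 ^ m * ballVolume ρ c + 2 ^ m * ballVolume (ρ ∸ 1) c)  ≡⟨ factor (2 ^ m) (ballVolume ρ c) _ ⟩
    2 * 2 ^ m * (ballVolume ρ c + ballVolume (ρ ∸ 1) c)          ≡⟨ cong (2 ^ suc m *_) (sym (ballVolume-suc ρ c)) ⟩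
    2 ^ suc m * ballVolume ρ (suc c)                             ∎
  where
  open ≡-Reasoning
  b₁ = ball ρ y
  b₀ = ball (ρ ∸ 1) y
  c = defined y
  distrib : ∀ a b P → (a + b) * (2 * P) ≡ 2 * (a * P + b * P)
  distrib = solve-∀
  factor : ∀ M u v → 2 * (M * u + M * v) ≡ 2 * M * (u + v)
  factor = solve-∀

ball-size : ∀ m ρ (x : PartialWord m) → ball ρ x * 2 ^ defined x ≡ 2 ^ m * ballVolume ρ (defined x)
ball-size zero zero x = refl
ball-size zero (suc ρ) x = refl
ball-size (suc m) ρ x with x zero
... | nothing = begin
    (b + b) * 2 ^ c               ≡⟨ double b (2 ^ c) ⟩
    2 * (b * 2 ^ c)               ≡⟨ cong (2 *_) (ball-size m ρ (tail x)) ⟩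
    2 * (2 ^ m * ballVolume ρ c)  ≡⟨ sym (*-assoc 2 (2 ^ m) _) ⟩
    2 ^ suc m * ballVolume ρ c    ∎
  where
  open ≡-Reasoning
  b = ball ρ (tail x)
  c = defined (tail x)
  double : ∀ a P → (a + a) * P ≡ 2 * (a * P)
  double = solve-∀
... | just true = ball-size-step m ρ (tail x) (ball-size m ρ (tail x)) (ball-size m (ρ ∸ 1) (tail x))
... | just false = trans (cong (_* 2 ^ suc (defined (tail x))) (+-comm (ball (ρ ∸ 1) (tail x)) _))
                         (ball-size-step m ρ (tail x) (ball-size m ρ (tail x)) (ball-size m (ρ ∸ 1) (tail x)))

-- The balls of radius ρ u around the words x u are pairwise disjoint; as in ball, radii are strict, so radius 0
-- means an empty ball and imposes nothing.
Separated : ∀ {n m} → (Fin n → PartialWord m) → (Fin n → ℕ) → Set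
Separated x ρ = ∀ {u v r s} → u ≢ v → ρ u ≡ suc r → ρ v ≡ suc s → r + s < distance (x u) (x v)

m∸n≡1+o⇒m≡1+o+n : ∀ m n {o} → m ∸ n ≡ suc o → m ≡ suc o + n
m∸n≡1+o⇒m≡1+o+n m zero eq = trans eq (sym (+-identityʳ _))
m∸n≡1+o⇒m≡1+o+n (suc m) (suc n) eq = trans (cong suc (m∸n≡1+o⇒m≡1+o+n m n eq)) (sym (+-suc _ n))

separated-tail : ∀ {n m} {x : Fin n → PartialWord (suc m)} {ρ : Fin n → ℕ} → Separated x ρ → ∀ b →
  Separated (tail ∘ x) (λ v → ρ v ∸ disagree (just b) (head (x v)))
separated-tail {x = x} {ρ} sep b {u} {v} {r} {s} u≢v ρu≡ ρv≡ = +-cancelˡ-≤ (eᵤ + eᵥ) _ _ (begin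
    eᵤ + eᵥ + suc (r + s)                         ≡⟨ rearrange eᵤ eᵥ r s ⟩
    suc (r + eᵤ + (s + eᵥ))  ≤⟨ sep u≢v (m∸n≡1+o⇒m≡1+o+n (ρ u) eᵤ ρu≡) (m∸n≡1+o⇒m≡1+o+n (ρ v) eᵥ ρv≡) ⟩
    distance (x u) (x v)     ≤⟨ +-monoˡ-≤ D′ (disagree-triangle b (head (x u)) (head (x v))) ⟩
    eᵤ + eᵥ + D′             ∎)
  where
  open ≤-Reasoning
  eᵤ = disagree (just b) (head (x u))
  eᵥ = disagree (just b) (head (x v))
  D′ = distance (tail (x u)) (tail (x v))
  rearrange : ∀ a b r s → a + b + suc (r + s) ≡ suc (r + a + (s + b))
  rearrange = solve-∀

kraft : ∀ m {n} (x : Fin n → PartialWord m) (ρ : Fin n → ℕ) → Separated x ρ → ∑[ v < n ] ball (ρ v) (x v) ≤ 2 ^ m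
kraft zero x ρ sep = sum≤1 _ ball≤1 at-most-one
  where
  ball≤1 : ∀ v → ball (ρ v) (x v) ≤ 1
  ball≤1 v with ρ v
  ... | zero = z≤n
  ... | suc _ = s≤s z≤n
  at-most-one : ∀ {u v} → u ≢ v → 0 < ball (ρ u) (x u) → 0 < ball (ρ v) (x v) → ⊥
  at-most-one {u} {v} u≢v _ _ with ρ u in ρu≡ | ρ v in ρv≡
  ... | suc r | suc s with () ← sep u≢v ρu≡ ρv≡
kraft (suc m) x ρ sep = begin
    ∑[ v < _ ] (T v + F v)  ≡⟨ ∑-distrib-+ T F ⟩
    sum T + sum F           ≤⟨ +-mono-≤ (kraft m _ _ (separated-tail {x = x} sep true))
                                        (kraft m _ _ (separated-tail {x = x} sep false)) ⟩
    2 ^ m + 2 ^ m           ≡⟨ cong (2 ^ m +_) (sym (+-identityʳ (2 ^ m))) ⟩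
    2 ^ suc m               ∎
  where
  open ≤-Reasoning
  T = λ v → ball (ρ v ∸ disagree (just true) (head (x v))) (tail (x v))
  F = λ v → ball (ρ v ∸ disagree (just false) (head (x v))) (tail (x v))

-- Thresholds and the tangent-line bound

IsThreshold : (ℕ → Set) → ℕ → Set
IsThreshold P c = P c × (∀ {c′} → c ≡ suc c′ → ¬ P c′)

threshold : ∀ {P : ℕ → Set} → (∀ c → Dec (P c)) → ∀ N → P N → ∃ (IsThreshold P)
threshold P? zero PN = zero , PN , λ ()
threshold P? (suc N) PN with P? N
... | yes PN′ = threshold P? N PN′
... | no ¬PN = suc N , PN , λ { refl → ¬PN }

tangent : ∀ M n c c₀ {W V} → (∀ t → c + t ≡ c₀ → suc t * 2 ^ c ≤ n * V) → W * 2 ^ c ≡ M * V →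
  M * suc c₀ ≤ M * c + n * W
tangent M n c c₀ {W} {V} below W2^c≡MV with suc c₀ ≤? c
... | yes c₀<c = ≤-trans (*-monoʳ-≤ M c₀<c) (m≤m+n (M * c) (n * W))
... | no c₀≮c = begin
    M * suc c₀         ≡⟨ cong (M *_) (sym (trans (+-suc c t) (cong suc c+t≡c₀))) ⟩
    M * (c + suc t)    ≡⟨ *-distribˡ-+ M c (suc t) ⟩
    M * c + M * suc t  ≤⟨ +-monoʳ-≤ (M * c) M[1+t]≤nW ⟩
    M * c + n * W      ∎
  where
  open ≤-Reasoning
  t = c₀ ∸ c
  c+t≡c₀ : c + t ≡ c₀
  c+t≡c₀ = m+[n∸m]≡n (≤-pred (≰⇒> c₀≮c))
  M[1+t]≤nW : M * suc t ≤ n * W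
  M[1+t]≤nW = *-cancelʳ-≤ _ _ (2 ^ c) {{m^n≢0 2 c}} (begin
    M * suc t * 2 ^ c    ≡⟨ *-assoc M (suc t) (2 ^ c) ⟩
    M * (suc t * 2 ^ c)  ≤⟨ *-monoʳ-≤ M (below t c+t≡c₀) ⟩
    M * (n * V)          ≡⟨ *.x∙yz≈y∙xz M n V ⟩
    n * (M * V)          ≡⟨ cong (n *_) (sym W2^c≡MV) ⟩
    n * (W * 2 ^ c)      ≡⟨ sym (*-assoc n W (2 ^ c)) ⟩
    n * W * 2 ^ c        ∎)

sum-tangent : ∀ {n} M .{{_ : NonZero M}} (c W : Fin n → ℕ) c₀ → sum W ≤ M →
  (∀ v → M * suc c₀ ≤ M * c v + n * W v) → n * c₀ ≤ sum c
sum-tangent {n} M c W c₀ ∑W≤M tangents = *-cancelˡ-≤ M (+-cancelʳ-≤ (M * n) _ _ (begin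
    M * (n * c₀) + M * n                         ≡⟨ regroup M n c₀ ⟩
    n * (M * suc c₀)                             ≡⟨ sym (∑-const n (M * suc c₀)) ⟩
    ∑[ v < n ] (M * suc c₀)                      ≤⟨ sum-mono-≤ tangents ⟩
    ∑[ v < n ] (M * c v + n * W v)               ≡⟨ ∑-distrib-+ (λ v → M * c v) (λ v → n * W v) ⟩
    ∑[ v < n ] (M * c v) + ∑[ v < n ] (n * W v)  ≡⟨ sym (cong₂ _+_ (*-distribˡ-sum M c) (*-distribˡ-sum n W)) ⟩
    M * sum c + n * sum W                        ≤⟨ +-monoʳ-≤ (M * sum c) (*-monoʳ-≤ n ∑W≤M) ⟩
    M * sum c + n * M                            ≡⟨ cong (M * sum c +_) (*-comm n M) ⟩
    M * sum c + M * n                            ∎))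
  where
  open ≤-Reasoning
  regroup : ∀ M n c → M * (n * c) + M * n ≡ n * (M * suc c)
  regroup = solve-∀

-- Sufficient c says c ≥ log n + k log (p / (l d)) - l - 1; 2 ^ p ≤ n ^ d says p / d ≤ log n.
module Sufficiency (n l p d k : ℕ) (2k+1≤l : 2 * k + 1 ≤ l) (1≤d : 1 ≤ d) (2^p≤n^d : 2 ^ p ≤ n ^ d) where

  Sufficient : ℕ → Set
  Sufficient c = n * p ^ k ≤ 2 ^ (c + l + 1) * (l * d) ^ k

  private
    [ld]^k>0 : (l * d) ^ k > 0
    [ld]^k>0 = m^n>0 (l * d) {{>-nonZero (*-mono-≤ (≤-trans (m≤n+m 1 (2 * k)) 2k+1≤l) 1≤d)}} k

  sufficient-large : Sufficient (n * p ^ k)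
  sufficient-large = begin
      N                              ≤⟨ <⇒≤ (n<2^n N) ⟩
      2 ^ N                          ≤⟨ ^-monoʳ-≤ 2 (≤-trans (m≤m+n N l) (m≤m+n (N + l) 1)) ⟩
      2 ^ (N + l + 1)                ≤⟨ m≤m*n _ ((l * d) ^ k) {{>-nonZero [ld]^k>0}} ⟩
      2 ^ (N + l + 1) * (l * d) ^ k  ∎
    where
    open ≤-Reasoning
    N = n * p ^ k

  sufficient-threshold : ∃ (IsThreshold Sufficient)
  sufficient-threshold = threshold (λ c → n * p ^ k ≤? 2 ^ (c + l + 1) * (l * d) ^ k) (n * p ^ k) sufficient-large

  sufficient-bound : ∀ c t → Sufficient (c + t) → suc t * p ^ k ≤ 2 ^ (t + l) * (l * d) ^ k * ballVolume (suc k) c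
  sufficient-bound c t suff with p ≤? l * d
  ... | yes p≤ld = begin
      suc t * p ^ k                                     ≤⟨ *-mono-≤ 1+t≤2^[t+l] (^-monoˡ-≤ k p≤ld) ⟩
      2 ^ (t + l) * (l * d) ^ k                         ≤⟨ m≤m*n _ (ballVolume (suc k) c) {{>-nonZero (ballVolume>0 k c)}} ⟩
      2 ^ (t + l) * (l * d) ^ k * ballVolume (suc k) c  ∎
    where
    open ≤-Reasoning
    1+t≤2^[t+l] : suc t ≤ 2 ^ (t + l)
    1+t≤2^[t+l] = ≤-trans (n<2^n t) (^-monoʳ-≤ 2 (m≤m+n t l))
  ... | no p≰ld = begin
      suc t * p ^ k                        ≤⟨ *-monoʳ-≤ (suc t) (^-monoˡ-≤ k p≤N*d) ⟩
      suc t * (N * d) ^ k                  ≡⟨ cong (suc t *_) (^-distribʳ-* N d k) ⟩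
      suc t * (N ^ k * d ^ k)              ≡⟨ sym (*-assoc (suc t) (N ^ k) (d ^ k)) ⟩
      suc t * N ^ k * d ^ k                ≡⟨ cong (λ z → suc t * z ^ k * d ^ k) (rearrange c t l) ⟩
      suc t * (c + l + suc t) ^ k * d ^ k  ≤⟨ *-monoˡ-≤ (d ^ k) (ballVolume-dominates l k c t 2k+1≤l) ⟩
      2 ^ (t + l) * l ^ k * V * d ^ k      ≡⟨ regroup (2 ^ (t + l)) (l ^ k) V (d ^ k) ⟩
      2 ^ (t + l) * (l ^ k * d ^ k) * V    ≡⟨ cong (λ z → 2 ^ (t + l) * z * V) (sym (^-distribʳ-* l d k)) ⟩
      2 ^ (t + l) * (l * d) ^ k * V        ∎
    where
    open ≤-Reasoning
    V = ballVolume (suc k) c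
    N = c + t + l + 1
    rearrange : ∀ c t l → c + t + l + 1 ≡ c + l + suc t
    rearrange = solve-∀
    regroup : ∀ A L b D → A * L * b * D ≡ A * (L * D) * b
    regroup = solve-∀
    n≤2^N : n ≤ 2 ^ N
    n≤2^N = *-cancelʳ-≤ n (2 ^ N) ((l * d) ^ k) {{>-nonZero [ld]^k>0}}
              (≤-trans (*-monoʳ-≤ n (^-monoˡ-≤ k (<⇒≤ (≰⇒> p≰ld)))) suff)
    p≤N*d : p ≤ N * d
    p≤N*d = 2^m≤2^n⇒m≤n (≤-trans 2^p≤n^d (≤-trans (^-monoˡ-≤ d n≤2^N) (≤-reflexive (^-*-assoc 2 N d))))

  threshold-crossing : ∀ c t c′ → c + t ≡ suc c′ → ¬ Sufficient c′ → Sufficient (c + t) →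
    suc t * 2 ^ c ≤ n * ballVolume (suc k) c
  threshold-crossing c t c′ c+t≡1+c′ insuff suff = *-cancelʳ-≤ _ _ X {{>-nonZero X>0}} (begin
      suc t * 2 ^ c * X                   ≡⟨ regroup (suc t) (2 ^ c) (2 ^ (t + l)) Lᵏ ⟩
      suc t * (2 ^ c * 2 ^ (t + l) * Lᵏ)  ≡⟨ cong (λ z → suc t * (z * Lᵏ)) (sym (^-distribˡ-+-* 2 c (t + l))) ⟩
      suc t * (2 ^ (c + (t + l)) * Lᵏ)    ≡⟨ cong (λ z → suc t * (2 ^ z * Lᵏ)) exponent≡ ⟩
      suc t * (2 ^ (c′ + l + 1) * Lᵏ)     ≤⟨ *-monoʳ-≤ (suc t) (<⇒≤ (≰⇒> insuff)) ⟩
      suc t * (n * p ^ k)                 ≡⟨ *.x∙yz≈y∙xz (suc t) n (p ^ k) ⟩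
      n * (suc t * p ^ k)                 ≤⟨ *-monoʳ-≤ n (sufficient-bound c t suff) ⟩
      n * (X * ballVolume (suc k) c)      ≡⟨ *.x∙yz≈xz∙y n X _ ⟩
      n * ballVolume (suc k) c * X        ∎)
    where
    open ≤-Reasoning
    Lᵏ = (l * d) ^ k
    X = 2 ^ (t + l) * Lᵏ
    X>0 : X > 0
    X>0 = *-mono-≤ (m^n>0 2 (t + l)) [ld]^k>0
    regroup : ∀ s P Q L → s * P * (Q * L) ≡ s * (P * Q * L)
    regroup = solve-∀
    exponent≡ : c + (t + l) ≡ c′ + l + 1
    exponent≡ = begin-equality
      c + (t + l)   ≡⟨ sym (+-assoc c t l) ⟩
      c + t + l     ≡⟨ cong (_+ l) c+t≡1+c′ ⟩
      suc c′ + l    ≡⟨ rotate c′ l ⟩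
      c′ + l + 1    ∎
      where
      rotate : ∀ c l → suc c + l ≡ c + l + 1
      rotate = solve-∀

  threshold-bound : ∀ {c₀} → IsThreshold Sufficient c₀ → n > 0 →
    ∀ c t → c + t ≡ c₀ → suc t * 2 ^ c ≤ n * ballVolume (suc k) c
  threshold-bound _ n>0 zero zero refl = ≤-trans n>0 (≤-reflexive (sym (*-identityʳ n)))
  threshold-bound (suff , below) _ zero (suc t) refl = threshold-crossing zero (suc t) t refl (below refl) suff
  threshold-bound (suff , below) _ (suc c) t refl = threshold-crossing (suc c) t (c + t) refl (below refl) suff

  sufficient⇒bound : ∀ {c S} → Sufficient c → n * c ≤ S →
    n ^ n * p ^ (k * n) ≤ 2 ^ (S + n * (l + 1)) * l ^ (k * n) * d ^ (k * n)
  sufficient⇒bound {c} {S} suff nc≤S = begin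
      n ^ n * p ^ (k * n)                                  ≡⟨ cong (n ^ n *_) (sym (^-*-assoc p k n)) ⟩
      n ^ n * (p ^ k) ^ n                                  ≡⟨ sym (^-distribʳ-* n (p ^ k) n) ⟩
      (n * p ^ k) ^ n                                      ≤⟨ ^-monoˡ-≤ n suff ⟩
      (2 ^ (c + l + 1) * (l * d) ^ k) ^ n                  ≡⟨ ^-distribʳ-* (2 ^ (c + l + 1)) ((l * d) ^ k) n ⟩
      (2 ^ (c + l + 1)) ^ n * ((l * d) ^ k) ^ n            ≡⟨ cong₂ _*_ (^-*-assoc 2 (c + l + 1) n) (^-*-assoc (l * d) k n) ⟩
      2 ^ ((c + l + 1) * n) * (l * d) ^ (k * n)            ≡⟨ cong (2 ^ ((c + l + 1) * n) *_) (^-distribʳ-* l d (k * n)) ⟩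
      2 ^ ((c + l + 1) * n) * (l ^ (k * n) * d ^ (k * n))  ≡⟨ sym (*-assoc (2 ^ ((c + l + 1) * n)) _ _) ⟩
      2 ^ ((c + l + 1) * n) * l ^ (k * n) * d ^ (k * n)    ≤⟨ *-monoˡ-≤ (d ^ (k * n)) (*-monoˡ-≤ (l ^ (k * n)) (^-monoʳ-≤ 2 exponent≤)) ⟩
      2 ^ (S + n * (l + 1)) * l ^ (k * n) * d ^ (k * n)    ∎
    where
    open ≤-Reasoning
    distrib : ∀ c l n → (c + l + 1) * n ≡ n * c + n * (l + 1)
    distrib = solve-∀
    exponent≤ : (c + l + 1) * n ≤ S + n * (l + 1)
    exponent≤ = ≤-trans (≤-reflexive (distrib c l n)) (+-monoˡ-≤ (n * (l + 1)) nc≤S)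

-- Bipartite graphs and coverings

∣p∣≡∑indicator : ∀ {n} (p : Subset n) → ∣ p ∣ ≡ ∑[ v < n ] indicator (lookup p v)
∣p∣≡∑indicator Vec.[] = refl
∣p∣≡∑indicator (true Vec.∷ p) = cong suc (∣p∣≡∑indicator p)
∣p∣≡∑indicator (false Vec.∷ p) = ∣p∣≡∑indicator p

cap≡∑order : ∀ {n m} (H : Fin m → BipGraph n) → cap H ≡ ∑[ i < m ] order (H i)
cap≡∑order H = trans (cong List.sum (map-tabulate (λ i → i) (order ∘ H))) (List-sum-tabulate (order ∘ H))

letter : ∀ {n} → BipGraph n → Fin n → Maybe Bool
letter G v = if lookup (verts G) v then just (colour G v) else nothing

is-just-letter : ∀ {n} (G : BipGraph n) v → is-just (letter G v) ≡ lookup (verts G) v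
is-just-letter G v with lookup (verts G) v
... | true = refl
... | false = refl

order≡∑defined : ∀ {n} (G : BipGraph n) → order G ≡ ∑[ v < n ] indicator (is-just (letter G v))
order≡∑defined G = trans (∣p∣≡∑indicator (verts G)) (sum-cong-≗ (λ v → cong indicator (sym (is-just-letter G v))))

endpoint-letter : ∀ {n} (G : BipGraph n) {u v} → adj G u v ≡ true → letter G u ≡ just (colour G u)
endpoint-letter G {u} {v} uv = cong (if_then just (colour G u) else nothing) ([]=⇒lookup (adj-in G u v uv))

indicator-xor-≢ : ∀ {b c} → b ≢ c → indicator (b xor c) ≡ 1
indicator-xor-≢ {true} {false} _ = refl
indicator-xor-≢ {false} {true} _ = refl
indicator-xor-≢ {true} {true} b≢c = ⊥-elim (b≢c refl)
indicator-xor-≢ {false} {false} b≢c = ⊥-elim (b≢c refl)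

edge⇒disagree : ∀ {n} (G : BipGraph n) {u v} → adj G u v ≡ true → disagree (letter G u) (letter G v) ≡ 1
edge⇒disagree G {u} {v} uv
  rewrite endpoint-letter G uv | endpoint-letter G (trans (adj-sym G v u) uv) = indicator-xor-≢ (proper G u v uv)

hasColour : Bool → Maybe Bool → ℕ
hasColour b (just c) = indicator (not (b xor c))
hasColour b nothing = 0

indicator-is-just : ∀ h → indicator (is-just h) ≡ hasColour true h + hasColour false h
indicator-is-just (just true) = refl
indicator-is-just (just false) = refl
indicator-is-just nothing = refl

opposite-colours : ∀ {b c} → b ≢ c →
  1 ≤ hasColour true (just b) * hasColour false (just c) + hasColour false (just b) * hasColour true (just c)
opposite-colours {true} {false} _ = s≤s z≤n
opposite-colours {false} {true} _ = s≤s z≤n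
opposite-colours {true} {true} b≢c = ⊥-elim (b≢c refl)
opposite-colours {false} {false} b≢c = ⊥-elim (b≢c refl)

edge-indicator≤ : ∀ {n} (G : BipGraph n) u v →
  indicator (adj G u v) ≤ hasColour true (letter G u) * hasColour false (letter G v)
                        + hasColour false (letter G u) * hasColour true (letter G v)
edge-indicator≤ G u v with adj G u v in uv
... | false = z≤n
... | true rewrite endpoint-letter G uv | endpoint-letter G (trans (adj-sym G v u) uv) = opposite-colours (proper G u v uv)

-- Each edge is counted twice.
edges : ∀ {n} → BipGraph n → ℕ
edges {n} G = ∑[ u < n ] ∑[ v < n ] indicator (adj G u v)

2*edges≤order*n : ∀ {n} (G : BipGraph n) → 2 * edges G ≤ order G * n
2*edges≤order*n {n} G = begin
    2 * edges G                                        ≤⟨ *-monoʳ-≤ 2 (sum-mono-≤ (λ u → sum-mono-≤ (edge-indicator≤ G u))) ⟩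
    2 * ∑[ u < n ] ∑[ v < n ] (A u * B v + B u * A v)  ≡⟨ cong (2 *_) count-pairs ⟩
    2 * (a * b + b * a)                                ≡⟨ double a b ⟩
    4 * (a * b)                                        ≤⟨ 4*[a*b]≤[a+b]*[a+b] a b ⟩
    (a + b) * (a + b)                                  ≤⟨ *-monoʳ-≤ (a + b) (≤-trans (≤-reflexive a+b≡order) (∣p∣≤n (verts G))) ⟩
    (a + b) * n                                        ≡⟨ cong (_* n) a+b≡order ⟩
    order G * n                                        ∎
  where
  open ≤-Reasoning
  A = λ u → hasColour true (letter G u)
  B = λ u → hasColour false (letter G u)
  a = sum A
  b = sum B
  count-pairs : ∑[ u < n ] ∑[ v < n ] (A u * B v + B u * A v) ≡ a * b + b * a
  count-pairs = begin-equality
    ∑[ u < n ] ∑[ v < n ] (A u * B v + B u * A v)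
      ≡⟨ sum-cong-≗ (λ u → ∑-distrib-+ (λ v → A u * B v) (λ v → B u * A v)) ⟩
    ∑[ u < n ] (∑[ v < n ] (A u * B v) + ∑[ v < n ] (B u * A v))
      ≡⟨ ∑-distrib-+ (λ u → ∑[ v < n ] (A u * B v)) (λ u → ∑[ v < n ] (B u * A v)) ⟩
    ∑[ u < n ] ∑[ v < n ] (A u * B v) + ∑[ u < n ] ∑[ v < n ] (B u * A v)
      ≡⟨ cong₂ _+_ (∑∑-product A B) (∑∑-product B A) ⟩
    a * b + b * a
      ∎
  a+b≡order : a + b ≡ order G
  a+b≡order = sym (trans (order≡∑defined G) (trans (sum-cong-≗ (indicator-is-just ∘ letter G)) (∑-distrib-+ A B)))
  double : ∀ a b → 2 * (a * b + b * a) ≡ 4 * (a * b)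
  double = solve-∀

module Covering {n l m : ℕ} (H : Fin m → BipGraph n) (cov : IsBipCoveringK n l m H) where

  covering-multiplicity : ∀ {u v} → u ≢ v → (g : Fin m → ℕ) → (∀ i → adj (H i) u v ≡ true → 1 ≤ g i) → l ≤ sum g
  covering-multiplicity {u} {v} u≢v g edge⇒1≤g with cov u v u≢v
  ... | f , f-inj , uv∈H∘f = begin
      l                   ≡⟨ sym (trans (∑-const l 1) (*-identityʳ l)) ⟩
      ∑[ j < l ] 1        ≤⟨ sum-mono-≤ (λ j → edge⇒1≤g (f j) (uv∈H∘f j)) ⟩
      ∑[ j < l ] g (f j)  ≤⟨ sum∘injection≤sum f f-inj g ⟩
      sum g               ∎
    where open ≤-Reasoning

  multiplicity : Fin n → Fin n → ℕ
  multiplicity u v = ∑[ i < m ] indicator (adj (H i) u v)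

  degree-bound : ∀ u → l * (n ∸ 1) ≤ ∑[ v < n ] multiplicity u v
  degree-bound u = sum-except-≥ l (multiplicity u) u
    (λ v u≢v → covering-multiplicity u≢v _ (λ i uv → ≤-reflexive (sym (cong indicator uv))))

  ∑multiplicity≡∑edges : ∑[ u < n ] ∑[ v < n ] multiplicity u v ≡ ∑[ i < m ] edges (H i)
  ∑multiplicity≡∑edges = trans (sum-cong-≗ (λ u → ∑-comm (λ v i → indicator (adj (H i) u v))))
                               (∑-comm (λ u i → ∑[ v < n ] indicator (adj (H i) u v)))

  cap-edge-bound : 2 * l * (n ∸ 1) ≤ cap H
  cap-edge-bound = cancel-n n {2 * l} (begin
      n * (2 * l * (n ∸ 1))                       ≡⟨ regroup n l (n ∸ 1) ⟩
      2 * (n * (l * (n ∸ 1)))                     ≡⟨ cong (2 *_) (sym (∑-const n (l * (n ∸ 1)))) ⟩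
      2 * ∑[ u < n ] (l * (n ∸ 1))                ≤⟨ *-monoʳ-≤ 2 (sum-mono-≤ degree-bound) ⟩
      2 * ∑[ u < n ] ∑[ v < n ] multiplicity u v  ≡⟨ cong (2 *_) ∑multiplicity≡∑edges ⟩
      2 * ∑[ i < m ] edges (H i)                  ≡⟨ *-distribˡ-sum 2 (edges ∘ H) ⟩
      ∑[ i < m ] (2 * edges (H i))                ≤⟨ sum-mono-≤ (2*edges≤order*n ∘ H) ⟩
      ∑[ i < m ] (order (H i) * n)                ≡⟨ sum-cong-≗ (λ i → *-comm (order (H i)) n) ⟩
      ∑[ i < m ] (n * order (H i))                ≡⟨ sym (*-distribˡ-sum n (order ∘ H)) ⟩
      n * ∑[ i < m ] order (H i)                  ≡⟨ cong (n *_) (sym (cap≡∑order H)) ⟩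
      n * cap H                                   ∎)
    where
    open ≤-Reasoning
    regroup : ∀ n l e → n * (2 * l * e) ≡ 2 * (n * (l * e))
    regroup = solve-∀
    cancel-n : ∀ n {a b} → n * (a * (n ∸ 1)) ≤ n * b → a * (n ∸ 1) ≤ b
    cancel-n zero {a} _ = ≤-trans (≤-reflexive (*-zeroʳ a)) z≤n
    cancel-n (suc n) = *-cancelˡ-≤ (suc n)

  word : Fin n → PartialWord m
  word v i = letter (H i) v

  cap≡∑defined : cap H ≡ ∑[ v < n ] defined (word v)
  cap≡∑defined = trans (cap≡∑order H)
    (trans (sum-cong-≗ (order≡∑defined ∘ H)) (∑-comm (λ i v → indicator (is-just (word v i)))))

  word-separated : ∀ {u v} → u ≢ v → l ≤ distance (word u) (word v)
  word-separated u≢v = covering-multiplicity u≢v _ (λ i uv → ≤-reflexive (sym (edge⇒disagree (H i) uv)))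

  cap-volume-bound : ∀ p d k → 2 * k + 1 ≤ l → 1 ≤ d → 2 ^ p ≤ n ^ d →
    n ^ n * p ^ (k * n) ≤ 2 ^ (cap H + n * (l + 1)) * l ^ (k * n) * d ^ (k * n)
  cap-volume-bound p d k 2k+1≤l 1≤d 2^p≤n^d =
    sufficient⇒bound (proj₁ c₀-threshold) (subst (n * c₀ ≤_) (sym cap≡∑defined) nc₀≤∑defined)
    where
    open Sufficiency n l p d k 2k+1≤l 1≤d 2^p≤n^d
    c₀ : ℕ
    c₀ = proj₁ sufficient-threshold
    c₀-threshold : IsThreshold Sufficient c₀
    c₀-threshold = proj₂ sufficient-threshold
    balls-disjoint : Separated word (λ _ → suc k)
    balls-disjoint {u} {v} u≢v refl refl = begin
      suc (k + k)                 ≡⟨ cong suc (cong (k +_) (sym (+-identityʳ k))) ⟩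
      suc (2 * k)                 ≡⟨ +-comm 1 (2 * k) ⟩
      2 * k + 1                   ≤⟨ 2k+1≤l ⟩
      l                           ≤⟨ word-separated u≢v ⟩
      distance (word u) (word v)  ∎
      where open ≤-Reasoning
    n>0 : Fin n → n > 0
    n>0 zero = s≤s z≤n
    n>0 (suc _) = s≤s z≤n
    nc₀≤∑defined : n * c₀ ≤ ∑[ v < n ] defined (word v)
    nc₀≤∑defined = sum-tangent (2 ^ m) {{m^n≢0 2 m}} (defined ∘ word) (λ v → ball (suc k) (word v)) c₀
      (kraft m word (λ _ → suc k) balls-disjoint)
      (λ v → tangent (2 ^ m) n (defined (word v)) c₀
               (threshold-bound c₀-threshold (n>0 v) (defined (word v))) (ball-size m (suc k) (word v)))

2*halfFloor[l]+1≤l : ∀ {l} → 1 ≤ l → 2 * halfFloor l + 1 ≤ l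
2*halfFloor[l]+1≤l {suc l} _ = begin
    2 * (l / 2) + 1  ≡⟨ cong (_+ 1) (*-comm 2 (l / 2)) ⟩
    l / 2 * 2 + 1    ≤⟨ +-monoˡ-≤ 1 (m/n*n≤m l 2) ⟩
    l + 1            ≡⟨ +-comm l 1 ⟩
    suc l            ∎
  where open ≤-Reasoning

theorem1p3 : ∀ (n l m : ℕ) (H : Fin m → BipGraph n) → IsBipCoveringK n l m H →
    (2 * l * (n ∸ 1) ≤ cap H)
    × (1 ≤ l → ∀ (p d : ℕ) → 1 ≤ d → 2 ^ p ≤ n ^ d →
        n ^ n * p ^ (halfFloor l * n)
          ≤ 2 ^ (cap H + n * (l + 1)) * l ^ (halfFloor l * n) * d ^ (halfFloor l * n))
theorem1p3 n l m H cov = cap-edge-bound , λ 1≤l p d 1≤d 2^p≤n^d →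
  cap-volume-bound p d (halfFloor l) (2*halfFloor[l]+1≤l 1≤l) 1≤d 2^p≤n^d
  where open Covering H cov
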